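{- Let $p>3$ be a prime and let $a,b,c,d\in\mathbb{Z}$ with $p\nmid abcd$. Let $E_1$ and $E_2$ be the elliptic curves over $\mathbb{F}_p$ given by $E_1: Y^2=X^3+\overline aX+\overline b$ and $E_2: Y^2=X^3+\overline cX+\overline d$, where $\overline z$ denotes reduction modulo $p$, and for $z$ coprime to $p$ let $z^{ -1}$ denote an integer with $zz^{ -1}\equiv1\pmod p$. (i) If $p\equiv1\pmod4$, then $E_1$ and $E_2$ are $\mathbb{F}_p$-isomorphic if and only if $ca^{ -1}$ is a biquadratic residue modulo $p$ and $c^3a^{ -3}\equiv d^2b^{ -2}\pmod p$. (ii) If $p\equiv3\pmod4$, then $E_1$ and $E_2$ are $\mathbb{F}_p$-isomorphic if and only if $ca^{ -1}$ and $db^{ -1}$ are quadratic residues modulo $p$ and $c^3a^{ -3}\equiv d^2b^{ -2}\pmod p$. -}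

module Defs where

open import Data.Nat using (ℕ)
open import Data.Integer using (ℤ; +_; _+_; _-_; _*_; _^_)
open import Data.Integer.Divisibility using (_∣_)
open import Data.Product using (∃-syntax; _×_)
open import Relation.Nullary using (¬_)

infix 4 _≡_[mod_]
_≡_[mod_] : ℤ → ℤ → ℕ → Set
x ≡ y [mod p ] = (+ p) ∣ (x - y)

-- A general Weierstrass equation
--   Y² + a₁XY + a₃Y = X³ + a₂X² + a₄X + a₆
-- with coefficients given by integer representatives of elements of F_p.
record Weierstrass : Set where
  constructor weierstrass
  field
    a₁ a₂ a₃ a₄ a₆ : ℤ
open Weierstrass public

short : ℤ → ℤ → Weierstrass
short A B = weierstrass (+ 0) (+ 0) (+ 0) A B

-- The admissible change of variables X = u²X' + r, Y = u³Y' + su²X' + t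
-- (u ≠ 0) transforms E into E' (Silverman, AEC, Table 3.1), over F_p.
TransformsVia : ℕ → Weierstrass → Weierstrass → ℤ → ℤ → ℤ → ℤ → Set
TransformsVia p E E' u r s t =
  (u * a₁ E' ≡ a₁ E + (+ 2) * s [mod p ]) ×
  (u ^ 2 * a₂ E' ≡ a₂ E - s * a₁ E + (+ 3) * r - s ^ 2 [mod p ]) ×
  (u ^ 3 * a₃ E' ≡ a₃ E + r * a₁ E + (+ 2) * t [mod p ]) ×
  (u ^ 4 * a₄ E' ≡ a₄ E - s * a₃ E + (+ 2) * r * a₂ E - (t + r * s) * a₁ E
                    + (+ 3) * r ^ 2 - (+ 2) * s * t [mod p ]) ×
  (u ^ 6 * a₆ E' ≡ a₆ E + r * a₄ E + r ^ 2 * a₂ E + r ^ 3 - t * a₃ E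
                    - t ^ 2 - r * t * a₁ E [mod p ])

-- E and E' are F_p-isomorphic: related by an admissible change of
-- variables with u, r, s, t ∈ F_p, u ≠ 0 (Silverman, AEC, Prop. III.3.1(b)).
IsoOver : ℕ → Weierstrass → Weierstrass → Set
IsoOver p E E' = ∃[ u ] ∃[ r ] ∃[ s ] ∃[ t ]
  (¬ (u ≡ + 0 [mod p ]) × TransformsVia p E E' u r s t)

QuadraticResidue : ℕ → ℤ → Set
QuadraticResidue p z = ∃[ x ] (x ^ 2 ≡ z [mod p ])

BiquadraticResidue : ℕ → ℤ → Set
BiquadraticResidue p z = ∃[ x ] (x ^ 4 ≡ z [mod p ])

-- Every admissible change of variables between two short Weierstrass equations over F_p
-- (p > 3) has r = s = t = 0, because 2 and 3 are units; so E₁ ≅ E₂ exactly when u⁴c ≡ a and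
-- u⁶d ≡ b for a unit u, i.e. when α = c a⁻¹ and β = d b⁻¹ are the fourth and sixth power of a
-- single w = u⁻¹. Such a w forces α³ ≡ β². Conversely, if α ≡ y² and β ≡ z² with α³ ≡ β², then
-- w = z y⁻¹ works; and if α ≡ x⁴, then (x⁶)² ≡ β² gives x⁶ ≡ ±β, so x or i x works, where i² ≡ -1.
-- For p = 4q + 1 such an i is found via Fermat's little theorem: some j ≤ 2q + 1 has
-- j^{2q} ≢ 1, since otherwise the 2q-th finite difference of x^{2q}, which is (2q)!, would vanish
-- mod p; then j^{2q} ≡ -1 and i = j^q.
module Submission where

open import Defs
open import Data.Nat as ℕ using (ℕ; zero; suc; _<_; _%_; _∸_; _!; z≤n; s≤s; NonZero)
import Data.Nat.Properties as ℕ
open import Data.Nat.Divisibility as ℕ using (_∤_)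
open import Data.Nat.DivMod using (m/n*n≡m; m≡m%n+[m/n]*n)
open import Data.Nat.Combinatorics using (_C_; nCn≡1; nCk≡n!/k![n-k]!; k![n∸k]!∣n!)
open import Data.Nat.Primality using (Prime; euclidsLemma; prime⇒nonZero; prime⇒nonTrivial)
import Data.Nat.Tactic.RingSolver as ℕ-Solver
open import Data.Integer as ℤ using (ℤ; +_; _+_; _-_; -_; _*_; _^_)
import Data.Integer.Properties as ℤ
open import Data.Integer.Divisibility using (_∣_)
open import Data.Integer.Divisibility.Signed as Signed
  using (divides; ∣ᵤ⇒∣; ∣⇒∣ᵤ; ∣m∣n⇒∣m+n; ∣m⇒∣-m; ∣n⇒∣m*n; ∣m⇒∣m*n)
open import Data.Integer.DivMod using (_%ℕ_; _/ℕ_; a≡a%ℕn+[a/ℕn]*n)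
open import Data.Integer.Tactic.RingSolver using (solve-∀)
open import Data.Integer.Solver using (module +-*-Solver)
open +-*-Solver using (solve; _:*_; _:^_; _:=_; :-_; con)
open import Data.Fin as Fin using (Fin; toℕ; inject₁; fromℕ)
import Data.Fin.Properties as Fin
open import Data.Product using (∃-syntax; _×_; _,_; proj₁; proj₂)
open import Data.Product.Function.NonDependent.Propositional using (_×-⇔_)
open import Data.Sum as Sum using (_⊎_; inj₁; inj₂; [_,_]′)
open import Function.Base using (id)
open import Function.Bundles using (_⇔_; mk⇔; Equivalence)
open import Function.Construct.Composition using (_⇔-∘_)
open import Function.Construct.Identity using (⇔-id)
open import Relation.Nullary using (¬_; Dec; contradiction)
import Relation.Nullary.Decidable as Dec
open import Relation.Binary.Bundles using (Setoid)
open import Relation.Binary.Structures using (IsEquivalence)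
open import Relation.Binary.PropositionalEquality
  using (_≡_; _≗_; refl; sym; trans; cong; cong₂; subst)
import Algebra.Properties.CommutativeSemiring.Binomial ℤ.+-*-commutativeSemiring as Binomial
open import Algebra.Properties.Monoid.Sum ℤ.+-0-monoid using (sum; sum-init-last)
import Algebra.Properties.Semiring.Exp ℤ.+-*-semiring as Semiring
import Algebra.Definitions.RawMonoid ℤ.+-0-rawMonoid as Monoid

semiring-^≡^ : ∀ x k → x Semiring.^ k ≡ x ^ k
semiring-^≡^ x zero    = refl
semiring-^≡^ x (suc k) = cong (x *_) (semiring-^≡^ x k)

monoid-×≡* : ∀ k x → k Monoid.× x ≡ + k * x
monoid-×≡* zero    x = sym (ℤ.*-zeroˡ x)
monoid-×≡* (suc k) x = trans (cong (_+_ x) (monoid-×≡* k x)) (distrib (+ k) x)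
  where
  distrib : ∀ k x → x + k * x ≡ (+ 1 + k) * x
  distrib = solve-∀

binomialTerm≡ : ∀ x y m k →
  Binomial.binomialTerm x y m k ≡ + (m C toℕ k) * (x ^ toℕ k * y ^ (m ∸ toℕ k))
binomialTerm≡ x y m k = trans (monoid-×≡* (m C toℕ k) _)
  (cong (+ (m C toℕ k) *_) (cong₂ _*_ (semiring-^≡^ x (toℕ k)) (semiring-^≡^ y (m ∸ toℕ k))))

n∣n! : ∀ n → .{{NonZero n}} → n ℕ.∣ n !
n∣n! (suc n) = ℕ.m∣m*n (n !)

Δ : (ℤ → ℤ) → ℤ → ℤ
Δ f x = f (x + + 1) - f x

Δ^ : ℕ → (ℤ → ℤ) → ℤ → ℤ
Δ^ zero    f = f
Δ^ (suc n) f = Δ^ n (Δ f)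

private
  variable
    c c′ : ℤ
    f g h : ℤ → ℤ

-- Leading n c f: f is a polynomial function of degree ≤ n with leading coefficient c, in the
-- sense that Δⁿ f is constantly n! c.
Leading : ℕ → ℤ → (ℤ → ℤ) → Set
Leading zero    c f = ∀ x → f x ≡ c
Leading (suc n) c f = Leading n (+ suc n * c) (Δ f)

Leading-≗ : ∀ n → f ≗ g → Leading n c f → Leading n c g
Leading-≗ zero    f≗g lead x = trans (sym (f≗g x)) (lead x)
Leading-≗ (suc n) f≗g lead = Leading-≗ n (λ x → cong₂ _-_ (f≗g (x + + 1)) (f≗g x)) lead

Leading-shift : ∀ n → Leading n c f → Leading n c (λ x → f (x + + 1))
Leading-shift zero    lead x = lead (x + + 1)
Leading-shift (suc n) lead = Leading-shift n lead

Leading-+ : ∀ n → Leading n c f → Leading n c′ g → Leading n (c + c′) (λ x → f x + g x)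
Leading-+ zero    leadf leadg x = cong₂ _+_ (leadf x) (leadg x)
Leading-+ {c = c} {f = f} {c′ = c′} {g = g} (suc n) leadf leadg =
  subst (λ e → Leading n e (Δ (λ x → f x + g x))) (distrib (+ suc n) c c′)
    (Leading-≗ n (λ x → interchange (f (x + + 1)) (f x) (g (x + + 1)) (g x)) (Leading-+ n leadf leadg))
  where
  distrib : ∀ k c c′ → k * c + k * c′ ≡ k * (c + c′)
  distrib = solve-∀
  interchange : ∀ a b a′ b′ → (a - b) + (a′ - b′) ≡ (a + a′) - (b + b′)
  interchange = solve-∀

-- Product rule: Δ (λ x → x * h x) x = h (x + 1) + x * Δ h x.
Leading-x* : ∀ n → Leading n c h → Leading (suc n) c (λ x → x * h x)
Leading-x* {c = c} zero lead x =
  trans (cong₂ (λ a b → (x + + 1) * a - x * b) (lead (x + + 1)) (lead x)) (difference x c)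
  where
  difference : ∀ x c → (x + + 1) * c - x * c ≡ + 1 * c
  difference = solve-∀
Leading-x* {c = c} {h = h} (suc n) lead =
  subst (λ e → Leading (suc n) e (Δ (λ x → x * h x))) (distrib (+ suc n) c)
    (Leading-≗ (suc n) (λ x → product-rule x (h (x + + 1)) (h x))
      (Leading-+ {f = λ x → h (x + + 1)} {g = λ x → x * Δ h x} (suc n)
        (Leading-shift {f = h} (suc n) lead) (Leading-x* n lead)))
  where
  distrib : ∀ k c → c + k * c ≡ (+ 1 + k) * c
  distrib = solve-∀
  product-rule : ∀ x a b → a + x * (a - b) ≡ (x + + 1) * a - x * b
  product-rule = solve-∀

Leading-^ : ∀ n → Leading n (+ 1) (_^ n)
Leading-^ zero    x = refl
Leading-^ (suc n) = Leading-x* n (Leading-^ n)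

Leading⇒Δ^ : ∀ n → Leading n c f → ∀ x → Δ^ n f x ≡ + (n !) * c
Leading⇒Δ^ {c = c} zero    lead x = trans (lead x) (sym (ℤ.*-identityˡ c))
Leading⇒Δ^ {c = c} (suc n) lead x = trans (Leading⇒Δ^ n lead x)
  (trans (sym (ℤ.*-assoc (+ (n !)) (+ suc n) c))
         (cong (_* c) (trans (ℤ.*-comm (+ (n !)) (+ suc n)) (sym (ℤ.pos-* (suc n) (n !))))))

Δ^-^ : ∀ n x → Δ^ n (_^ n) x ≡ + (n !)
Δ^-^ n x = trans (Leading⇒Δ^ n (Leading-^ n) x) (ℤ.*-identityʳ (+ (n !)))

module Congruence (n : ℕ) where

  private
    variable
      x y z u v : ℤ

    n∣_ : ℤ → Set
    n∣ z = + n Signed.∣ z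

  -- A record rather than a synonym for _≡_[mod n ], so that x and y are inferable from x ≈ y.
  infix 4 _≈_
  record _≈_ (x y : ℤ) : Set where
    constructor mod⇒≈
    field ≈⇒mod : x ≡ y [mod n ]
  open _≈_ public

  private
    fromDivides : n∣ (x - y) → x ≈ y
    fromDivides n∣x-y = mod⇒≈ (∣⇒∣ᵤ n∣x-y)

    toDivides : x ≈ y → n∣ (x - y)
    toDivides x≈y = ∣ᵤ⇒∣ (≈⇒mod x≈y)

  ≈-refl : x ≈ x
  ≈-refl {x} = fromDivides (divides (+ 0) (ℤ.+-inverseʳ x))

  ≈-reflexive : x ≡ y → x ≈ y
  ≈-reflexive refl = ≈-refl

  ≈-sym : x ≈ y → y ≈ x
  ≈-sym {x} {y} x≈y = fromDivides (subst n∣_ (negate x y) (∣m⇒∣-m (toDivides x≈y)))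
    where
    negate : ∀ x y → - (x - y) ≡ y - x
    negate = solve-∀

  ≈-trans : x ≈ y → y ≈ z → x ≈ z
  ≈-trans {x} {y} {z} x≈y y≈z =
    fromDivides (subst n∣_ (telescope x y z) (∣m∣n⇒∣m+n (toDivides x≈y) (toDivides y≈z)))
    where
    telescope : ∀ x y z → (x - y) + (y - z) ≡ x - z
    telescope = solve-∀

  ≈-isEquivalence : IsEquivalence _≈_
  ≈-isEquivalence = record { refl = ≈-refl ; sym = ≈-sym ; trans = ≈-trans }

  ≈-setoid : Setoid _ _
  ≈-setoid = record { isEquivalence = ≈-isEquivalence }

  open import Relation.Binary.Reasoning.Setoid ≈-setoid

  _≈?_ : ∀ x y → Dec (x ≈ y)
  x ≈? y = Dec.map′ mod⇒≈ ≈⇒mod (n ℕ.∣? ℤ.∣ x - y ∣)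

  +-cong : x ≈ y → u ≈ v → x + u ≈ y + v
  +-cong {x} {y} {u} {v} x≈y u≈v =
    fromDivides (subst n∣_ (regroup x y u v) (∣m∣n⇒∣m+n (toDivides x≈y) (toDivides u≈v)))
    where
    regroup : ∀ x y u v → (x - y) + (u - v) ≡ (x + u) - (y + v)
    regroup = solve-∀

  -‿cong : x ≈ y → - x ≈ - y
  -‿cong {x} {y} x≈y = fromDivides (subst n∣_ (negate x y) (∣m⇒∣-m (toDivides x≈y)))
    where
    negate : ∀ x y → - (x - y) ≡ - x - - y
    negate = solve-∀

  *-cong : x ≈ y → u ≈ v → x * u ≈ y * v
  *-cong {x} {y} {u} {v} x≈y u≈v =
    fromDivides (subst n∣_ (regroup x y u v)
      (∣m∣n⇒∣m+n (∣n⇒∣m*n x (toDivides u≈v)) (∣m⇒∣m*n v (toDivides x≈y))))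
    where
    regroup : ∀ x y u v → x * (u - v) + (x - y) * v ≡ x * u - y * v
    regroup = solve-∀

  ^-cong : ∀ k → x ≈ y → x ^ k ≈ y ^ k
  ^-cong zero    x≈y = ≈-refl
  ^-cong (suc k) x≈y = *-cong x≈y (^-cong k x≈y)

  ≈0⇒∣ : x ≈ + 0 → + n ∣ x
  ≈0⇒∣ {x} x≈0 = subst (+ n ∣_) (ℤ.+-identityʳ x) (≈⇒mod x≈0)

  ∣⇒≈0 : + n ∣ x → x ≈ + 0
  ∣⇒≈0 {x} n∣x = mod⇒≈ (subst (+ n ∣_) (sym (ℤ.+-identityʳ x)) n∣x)

  x≈y⇒x-y≈0 : x ≈ y → x - y ≈ + 0
  x≈y⇒x-y≈0 x≈y = ∣⇒≈0 (≈⇒mod x≈y)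

  x-y≈0⇒x≈y : x - y ≈ + 0 → x ≈ y
  x-y≈0⇒x≈y x-y≈0 = mod⇒≈ (≈0⇒∣ x-y≈0)

  *-zeroˡ-≈ : x ≈ + 0 → x * y ≈ + 0
  *-zeroˡ-≈ {x} {y} x≈0 = ≈-trans (*-cong x≈0 (≈-refl {y})) (≈-reflexive (ℤ.*-zeroˡ y))

  *-zeroʳ-≈ : y ≈ + 0 → x * y ≈ + 0
  *-zeroʳ-≈ {y} {x} y≈0 = ≈-trans (*-cong (≈-refl {x}) y≈0) (≈-reflexive (ℤ.*-zeroʳ x))

  ≈-%ℕ : .{{_ : NonZero n}} → ∀ x → x ≈ + (x %ℕ n)
  ≈-%ℕ x = fromDivides (divides (x /ℕ n)
    (trans (cong (_- r) (a≡a%ℕn+[a/ℕn]*n x n)) (cancel r (x /ℕ n) (+ n))))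
    where
    r : ℤ
    r = + (x %ℕ n)
    cancel : ∀ r q n → r + q * n - r ≡ q * n
    cancel = solve-∀

  ^-inverse : ∀ k → x * y ≈ + 1 → x ^ k * y ^ k ≈ + 1
  ^-inverse zero    xy≈1 = ≈-refl
  ^-inverse {x} {y} (suc k) xy≈1 = begin
    x * x ^ k * (y * y ^ k)      ≡⟨ interchange x (x ^ k) y (y ^ k) ⟩
    x * y * (x ^ k * y ^ k)      ≈⟨ *-cong xy≈1 (^-inverse k xy≈1) ⟩
    + 1 * + 1                    ∎
    where
    interchange : ∀ x X y Y → x * X * (y * Y) ≡ x * y * (X * Y)
    interchange = solve-∀

  x*c≈a⇔x⁻¹≈c*a⁻¹ : ∀ {x x⁻¹ a a⁻¹ c} → x * x⁻¹ ≈ + 1 → a * a⁻¹ ≈ + 1 →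
                    (x * c ≈ a ⇔ x⁻¹ ≈ c * a⁻¹)
  x*c≈a⇔x⁻¹≈c*a⁻¹ {x} {x⁻¹} {a} {a⁻¹} {c} xx⁻¹≈1 aa⁻¹≈1 = mk⇔ to from
    where
    to : x * c ≈ a → x⁻¹ ≈ c * a⁻¹
    to xc≈a = begin
      x⁻¹                    ≡⟨ ℤ.*-identityʳ x⁻¹ ⟨
      x⁻¹ * + 1              ≈⟨ *-cong (≈-refl {x⁻¹}) aa⁻¹≈1 ⟨
      x⁻¹ * (a * a⁻¹)        ≈⟨ *-cong (≈-refl {x⁻¹}) (*-cong xc≈a (≈-refl {a⁻¹})) ⟨
      x⁻¹ * (x * c * a⁻¹)    ≡⟨ regroup x x⁻¹ c a⁻¹ ⟩
      x * x⁻¹ * (c * a⁻¹)    ≈⟨ *-cong xx⁻¹≈1 (≈-refl {c * a⁻¹}) ⟩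
      + 1 * (c * a⁻¹)        ≡⟨ ℤ.*-identityˡ (c * a⁻¹) ⟩
      c * a⁻¹                ∎
      where
      regroup : ∀ x x⁻¹ c a⁻¹ → x⁻¹ * (x * c * a⁻¹) ≡ x * x⁻¹ * (c * a⁻¹)
      regroup = solve-∀

    from : x⁻¹ ≈ c * a⁻¹ → x * c ≈ a
    from x⁻¹≈ca⁻¹ = begin
      x * c                  ≡⟨ ℤ.*-identityʳ (x * c) ⟨
      x * c * + 1            ≈⟨ *-cong (≈-refl {x * c}) aa⁻¹≈1 ⟨
      x * c * (a * a⁻¹)      ≡⟨ regroup x c a a⁻¹ ⟩
      x * (c * a⁻¹) * a      ≈⟨ *-cong (*-cong (≈-refl {x}) x⁻¹≈ca⁻¹) (≈-refl {a}) ⟨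
      x * x⁻¹ * a            ≈⟨ *-cong xx⁻¹≈1 (≈-refl {a}) ⟩
      + 1 * a                ≡⟨ ℤ.*-identityˡ a ⟩
      a                      ∎
      where
      regroup : ∀ x c a a⁻¹ → x * c * (a * a⁻¹) ≡ x * (c * a⁻¹) * a
      regroup = solve-∀

  sum-≈0 : ∀ {k} (t : Fin k → ℤ) → (∀ i → t i ≈ + 0) → sum t ≈ + 0
  sum-≈0 {zero}  t t≈0 = ≈-refl
  sum-≈0 {suc k} t t≈0 = +-cong (t≈0 Fin.zero) (sum-≈0 (λ i → t (Fin.suc i)) (λ i → t≈0 (Fin.suc i)))

  freshman's-dream : ∀ e → 0 < e → (∀ k → 0 < k → k < e → n ℕ.∣ e C k) →
                     ∀ y → (+ 1 + y) ^ e ≈ + 1 + y ^ e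
  freshman's-dream (suc m) _ n∣C y = begin
    (+ 1 + y) ^ suc m                         ≡⟨ semiring-^≡^ (+ 1 + y) (suc m) ⟨
    (+ 1 + y) Semiring.^ suc m                ≡⟨ Binomial.theorem (suc m) (+ 1) y ⟩
    t Fin.zero + sum (λ i → t (Fin.suc i))    ≡⟨ cong (_+_ (t Fin.zero)) (sum-init-last (λ i → t (Fin.suc i))) ⟩
    t Fin.zero + (sum middle + t (fromℕ (suc m)))
      ≈⟨ +-cong (≈-reflexive first) (+-cong (sum-≈0 middle middle≈0) (≈-reflexive last)) ⟩
    y ^ suc m + (+ 0 + + 1)                   ≡⟨ regroup (y ^ suc m) ⟩
    + 1 + y ^ suc m                           ∎
    where
    t : Fin (suc (suc m)) → ℤ
    t = Binomial.binomialTerm (+ 1) y (suc m)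

    middle : Fin m → ℤ
    middle i = t (Fin.suc (inject₁ i))

    regroup : ∀ z → z + (+ 0 + + 1) ≡ + 1 + z
    regroup = solve-∀

    first : t Fin.zero ≡ y ^ suc m
    first = trans (binomialTerm≡ (+ 1) y (suc m) Fin.zero) (trans (ℤ.*-identityˡ _) (ℤ.*-identityˡ _))

    last : t (fromℕ (suc m)) ≡ + 1
    last = trans (binomialTerm≡ (+ 1) y (suc m) (fromℕ (suc m)))
             (trans (cong (λ k → + (suc m C k) * ((+ 1) ^ k * y ^ (suc m ∸ k))) (Fin.toℕ-fromℕ (suc m)))
                    (diagonal (suc m)))
      where
      diagonal : ∀ k → + (k C k) * ((+ 1) ^ k * y ^ (k ∸ k)) ≡ + 1
      diagonal k rewrite nCn≡1 k | ℕ.n∸n≡0 k | ℤ.^-zeroˡ k = refl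

    middle≈0 : ∀ i → middle i ≈ + 0
    middle≈0 i = ≈-trans (≈-reflexive (binomialTerm≡ (+ 1) y (suc m) (Fin.suc (inject₁ i))))
                   (*-zeroˡ-≈ {+ (suc m C suc (toℕ (inject₁ i)))} (∣⇒≈0 (n∣C _ (s≤s z≤n) (s≤s k<m))))
      where
      k<m : toℕ (inject₁ i) < m
      k<m = subst (_< m) (sym (Fin.toℕ-inject₁ i)) (Fin.toℕ<n i)

  Δ-≈0 : ∀ {k e} f x → (∀ (j : Fin (suc k)) → f (x + + toℕ j) ≈ e) →
         ∀ (j : Fin k) → Δ f (x + + toℕ j) ≈ + 0
  Δ-≈0 {e = e} f x f≈e j = begin
    f (x + + toℕ j + + 1) - f (x + + toℕ j)
      ≡⟨ cong₂ _-_ (cong f (step x (+ toℕ j))) (cong (λ i → f (x + + i)) (sym (Fin.toℕ-inject₁ j))) ⟩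
    f (x + + toℕ (Fin.suc j)) - f (x + + toℕ (inject₁ j))
      ≈⟨ +-cong (f≈e (Fin.suc j)) (-‿cong (f≈e (inject₁ j))) ⟩
    e - e
      ≡⟨ ℤ.+-inverseʳ e ⟩
    + 0 ∎
    where
    step : ∀ x i → x + i + + 1 ≡ x + (+ 1 + i)
    step = solve-∀

  Δ^-≈0 : ∀ {k} f x → (∀ (j : Fin (suc k)) → f (x + + toℕ j) ≈ + 0) → Δ^ k f x ≈ + 0
  Δ^-≈0 {zero}  f x f≈0 = ≈-trans (≈-reflexive (cong f (sym (ℤ.+-identityʳ x)))) (f≈0 Fin.zero)
  Δ^-≈0 {suc k} f x f≈0 = Δ^-≈0 (Δ f) x (Δ-≈0 f x f≈0)

module PrimeModulus (p : ℕ) (p-prime : Prime p) where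
  open Congruence p
  open import Relation.Binary.Reasoning.Setoid ≈-setoid

  private
    instance
      p≢0 : NonZero p
      p≢0 = prime⇒nonZero p-prime

    variable
      x y z : ℤ

  1<p : 1 < p
  1<p = ℕ.nonTrivial⇒n>1 p {{prime⇒nonTrivial p-prime}}

  x*y≈0⇒x≈0⊎y≈0 : x * y ≈ + 0 → x ≈ + 0 ⊎ y ≈ + 0
  x*y≈0⇒x≈0⊎y≈0 {x} {y} xy≈0 =
    Sum.map ∣⇒≈0 ∣⇒≈0 (euclidsLemma ℤ.∣ x ∣ ℤ.∣ y ∣ p-prime (subst (p ℕ.∣_) (ℤ.abs-* x y) (≈0⇒∣ xy≈0)))

  x≉0∧y≉0⇒x*y≉0 : ¬ x ≈ + 0 → ¬ y ≈ + 0 → ¬ x * y ≈ + 0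
  x≉0∧y≉0⇒x*y≉0 {x} {y} x≉0 y≉0 xy≈0 = [ x≉0 , y≉0 ]′ (x*y≈0⇒x≈0⊎y≈0 {x} {y} xy≈0)

  *-cancelˡ-≈ : ¬ x ≈ + 0 → x * y ≈ x * z → y ≈ z
  *-cancelˡ-≈ {x} {y} {z} x≉0 xy≈xz =
    [ (λ x≈0 → contradiction x≈0 x≉0) , x-y≈0⇒x≈y ]′
      (x*y≈0⇒x≈0⊎y≈0 {x} {y - z} (≈-trans (≈-reflexive (factor x y z)) (x≈y⇒x-y≈0 xy≈xz)))
    where
    factor : ∀ x y z → x * (y - z) ≡ x * y - x * z
    factor = solve-∀

  x*x≈y*y⇒x≈±y : x * x ≈ y * y → x ≈ y ⊎ x ≈ - y
  x*x≈y*y⇒x≈±y {x} {y} xx≈yy =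
    Sum.map x-y≈0⇒x≈y (λ x+y≈0 → x-y≈0⇒x≈y (≈-trans (≈-reflexive x+--y≡x+y) x+y≈0))
      (x*y≈0⇒x≈0⊎y≈0 {x - y} {x + y} (≈-trans (≈-reflexive (factor x y)) (x≈y⇒x-y≈0 xx≈yy)))
    where
    x+--y≡x+y : x - - y ≡ x + y
    x+--y≡x+y = cong (_+_ x) (ℤ.neg-involutive y)

    factor : ∀ x y → (x - y) * (x + y) ≡ x * x - y * y
    factor = solve-∀

  +k≉0 : ∀ {k} → 0 < k → k < p → ¬ + k ≈ + 0
  +k≉0 {suc k} _ k<p k≈0 = ℕ.<⇒≱ k<p (ℕ.∣⇒≤ (≈0⇒∣ k≈0))

  1≉0 : ¬ + 1 ≈ + 0
  1≉0 = +k≉0 (s≤s z≤n) 1<p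

  +k*x≈0⇒x≈0 : ∀ {k} → 0 < k → k < p → + k * x ≈ + 0 → x ≈ + 0
  +k*x≈0⇒x≈0 {x} {k} 0<k k<p kx≈0 =
    [ (λ k≈0 → contradiction k≈0 (+k≉0 0<k k<p)) , id ]′ (x*y≈0⇒x≈0⊎y≈0 {+ k} {x} kx≈0)

  x*y≈1⇒y≉0 : x * y ≈ + 1 → ¬ y ≈ + 0
  x*y≈1⇒y≉0 {x} xy≈1 y≈0 = 1≉0 (≈-trans (≈-sym xy≈1) (*-zeroʳ-≈ {x = x} y≈0))

  p∤m! : ∀ {m} → m < p → p ∤ m !
  p∤m! {zero}  _   p∣1 = 1≉0 (∣⇒≈0 p∣1)
  p∤m! {suc m} m<p p∣m! with euclidsLemma (suc m) (m !) p-prime p∣m!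
  ... | inj₁ p∣1+m = ℕ.<⇒≱ m<p (ℕ.∣⇒≤ p∣1+m)
  ... | inj₂ p∣m!  = p∤m! (ℕ.<-trans (ℕ.n<1+n m) m<p) p∣m!

  p∣pCk : ∀ {k} → 0 < k → k < p → p ℕ.∣ p C k
  p∣pCk {k} 0<k k<p with euclidsLemma (p C k) (k ! ℕ.* (p ∸ k) !) p-prime p∣pCk*k![p-k]!
    where
    instance
      k![p-k]!≢0 : NonZero (k ! ℕ.* (p ∸ k) !)
      k![p-k]!≢0 = k ℕ.!* (p ∸ k) !≢0

    pCk*k![p-k]!≡p! : (p C k) ℕ.* (k ! ℕ.* (p ∸ k) !) ≡ p !
    pCk*k![p-k]!≡p! = trans (cong (ℕ._* (k ! ℕ.* (p ∸ k) !)) (nCk≡n!/k![n-k]! (ℕ.<⇒≤ k<p)))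
                            (m/n*n≡m (k![n∸k]!∣n! (ℕ.<⇒≤ k<p)))

    p∣pCk*k![p-k]! : p ℕ.∣ (p C k) ℕ.* (k ! ℕ.* (p ∸ k) !)
    p∣pCk*k![p-k]! = subst (p ℕ.∣_) (sym pCk*k![p-k]!≡p!) (n∣n! p)
  ... | inj₁ p∣pCk = p∣pCk
  ... | inj₂ p∣k![p-k]! with euclidsLemma (k !) ((p ∸ k) !) p-prime p∣k![p-k]!
  ...   | inj₁ p∣k!     = contradiction p∣k! (p∤m! k<p)
  ...   | inj₂ p∣[p-k]! = contradiction p∣[p-k]! (p∤m! (ℕ.∸-monoʳ-< 0<k (ℕ.<⇒≤ k<p)))

  fermat-ℕ : ∀ m → (+ m) ^ p ≈ + m
  fermat-ℕ zero    = ≈-reflexive (cong (_^_ (+ 0)) (sym (ℕ.suc-pred p)))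
  fermat-ℕ (suc m) = begin
    (+ 1 + + m) ^ p  ≈⟨ freshman's-dream p (ℕ.<-trans (s≤s z≤n) 1<p) (λ _ → p∣pCk) (+ m) ⟩
    + 1 + (+ m) ^ p  ≈⟨ +-cong (≈-refl {+ 1}) (fermat-ℕ m) ⟩
    + 1 + + m        ∎

  fermat : ∀ x → x ^ p ≈ x
  fermat x = begin
    x ^ p               ≈⟨ ^-cong p (≈-%ℕ x) ⟩
    (+ (x %ℕ p)) ^ p    ≈⟨ fermat-ℕ (x %ℕ p) ⟩
    + (x %ℕ p)          ≈⟨ ≈-%ℕ x ⟨
    x                   ∎

  fermat-unit : ∀ {k} → p ≡ suc k → ¬ x ≈ + 0 → x ^ k ≈ + 1
  fermat-unit {x} {k} p≡1+k x≉0 = *-cancelˡ-≈ x≉0 (begin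
    x * x ^ k  ≡⟨ cong (x ^_) (sym p≡1+k) ⟩
    x ^ p      ≈⟨ fermat x ⟩
    x          ≡⟨ ℤ.*-identityʳ x ⟨
    x * + 1    ∎)

  inverse : ¬ x ≈ + 0 → ∃[ x⁻¹ ] x * x⁻¹ ≈ + 1
  inverse {x} x≉0 = let k , 2+k≡p = ℕ.m≤n⇒∃[o]m+o≡n 1<p in x ^ k , fermat-unit (sym 2+k≡p) x≉0

  -- Otherwise the m-th difference of x ↦ xᵐ at 1, which is m!, would vanish mod p.
  small-non-root : ∀ m → 0 < m → m < p → ∃[ j ] ¬ (+ suc (toℕ {suc m} j)) ^ m ≈ + 1
  small-non-root (suc m) _ 1+m<p = Fin.¬∀⟶∃¬ (suc (suc m)) _ (λ j → _ ≈? _) all-roots⇒p∣m!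
    where
    all-roots⇒p∣m! : ¬ (∀ j → (+ suc (toℕ {suc (suc m)} j)) ^ suc m ≈ + 1)
    all-roots⇒p∣m! roots = p∤m! 1+m<p (≈0⇒∣ (begin
      + (suc m !)                      ≡⟨ Δ^-^ (suc m) (+ 1) ⟨
      Δ^ (suc m) (_^ suc m) (+ 1)      ≈⟨ Δ^-≈0 (Δ (_^ suc m)) (+ 1) (Δ-≈0 (_^ suc m) (+ 1) roots) ⟩
      + 0                              ∎))

  √-1 : p % 4 ≡ 1 → ∃[ i ] i * i ≈ - + 1
  √-1 p%4≡1 = √-1-from (p ℕ./ 4) (trans (m≡m%n+[m/n]*n p 4) (cong₂ ℕ._+_ p%4≡1 (four-halves (p ℕ./ 4))))
    where
    four-halves : ∀ q → q ℕ.* 4 ≡ (q ℕ.+ q) ℕ.+ (q ℕ.+ q)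
    four-halves = ℕ-Solver.solve-∀

    √-1-from : ∀ q → p ≡ suc ((q ℕ.+ q) ℕ.+ (q ℕ.+ q)) → ∃[ i ] i * i ≈ - + 1
    √-1-from zero    p≡1    = contradiction 1<p (ℕ.<-irrefl (sym p≡1))
    √-1-from (suc q) p≡1+4q = j ^ suc q , (begin
      j ^ suc q * j ^ suc q  ≡⟨ ℤ.^-distribˡ-+-* j (suc q) (suc q) ⟨
      j ^ m                  ≈⟨ jᵐ≈-1 ⟩
      - + 1                  ∎)
      where
      m : ℕ
      m = suc q ℕ.+ suc q

      1+m<p : suc m < p
      1+m<p = subst (suc m <_) (sym p≡1+4q) (s≤s (ℕ.m<m+n m (s≤s z≤n)))

      non-root : ∃[ j ] ¬ (+ suc (toℕ {suc m} j)) ^ m ≈ + 1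
      non-root = small-non-root m (s≤s z≤n) (ℕ.<-trans (ℕ.n<1+n m) 1+m<p)

      j : ℤ
      j = + suc (toℕ (proj₁ non-root))

      j≉0 : ¬ j ≈ + 0
      j≉0 = +k≉0 (s≤s z≤n) (ℕ.≤-<-trans (Fin.toℕ<n (proj₁ non-root)) 1+m<p)

      jᵐ≈-1 : j ^ m ≈ - + 1
      jᵐ≈-1 = [ (λ jᵐ≈1 → contradiction jᵐ≈1 (proj₂ non-root)) , id ]′
        (x*x≈y*y⇒x≈±y {j ^ m} {+ 1} (≈-trans (≈-reflexive (sym (ℤ.^-distribˡ-+-* j m m)))
                                            (fermat-unit p≡1+4q j≉0)))

module ShortWeierstrass (p : ℕ) (p-prime : Prime p) (3<p : 3 < p) where
  open Congruence p
  open PrimeModulus p p-prime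
  open import Relation.Binary.Reasoning.Setoid ≈-setoid

  ScalingIso : ℤ → ℤ → ℤ → ℤ → Set
  ScalingIso a b c d = ∃[ u ] (¬ u ≈ + 0 × u ^ 4 * c ≈ a × u ^ 6 * d ≈ b)

  -- As 2 and 3 are units mod p, the equations for a₁, a₂ and a₃ force s ≡ r ≡ t ≡ 0.
  transform⇒shifts≈0 : ∀ {a b c d u r s t} → TransformsVia p (short a b) (short c d) u r s t →
                       r ≈ + 0 × s ≈ + 0 × t ≈ + 0
  transform⇒shifts≈0 {u = u} {r} {s} {t} (e₁ , e₂ , e₃ , _) = r≈0 , s≈0 , t≈0
    where
    e₁′ : u * + 0 ≈ + 0 + + 2 * s
    e₁′ = mod⇒≈ e₁
    e₂′ : u ^ 2 * + 0 ≈ + 0 - s * + 0 + + 3 * r - s ^ 2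
    e₂′ = mod⇒≈ e₂
    e₃′ : u ^ 3 * + 0 ≈ + 0 + r * + 0 + + 2 * t
    e₃′ = mod⇒≈ e₃

    2<p : 2 < p
    2<p = ℕ.<-trans (s≤s (s≤s (s≤s z≤n))) 3<p

    s≈0 : s ≈ + 0
    s≈0 = +k*x≈0⇒x≈0 {k = 2} (s≤s z≤n) 2<p (begin
      + 2 * s          ≡⟨ ℤ.+-identityˡ (+ 2 * s) ⟨
      + 0 + + 2 * s    ≈⟨ e₁′ ⟨
      u * + 0          ≡⟨ ℤ.*-zeroʳ u ⟩
      + 0              ∎)

    r≈0 : r ≈ + 0
    r≈0 = +k*x≈0⇒x≈0 {k = 3} (s≤s z≤n) 3<p (begin
      + 3 * r                                   ≡⟨ isolate r s ⟩
      + 0 - s * + 0 + + 3 * r - s ^ 2 + s * s   ≈⟨ +-cong e₂′ (≈-sym (*-zeroˡ-≈ s≈0)) ⟨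
      u ^ 2 * + 0 + + 0                         ≡⟨ trans (ℤ.+-identityʳ (u ^ 2 * + 0)) (ℤ.*-zeroʳ (u ^ 2)) ⟩
      + 0                                       ∎)
      where
      isolate : ∀ r s → + 3 * r ≡ + 0 - s * + 0 + + 3 * r - s * (s * + 1) + s * s
      isolate = solve-∀

    t≈0 : t ≈ + 0
    t≈0 = +k*x≈0⇒x≈0 {k = 2} (s≤s z≤n) 2<p (begin
      + 2 * t                     ≡⟨ isolate r t ⟩
      + 0 + r * + 0 + + 2 * t     ≈⟨ e₃′ ⟨
      u ^ 3 * + 0                 ≡⟨ ℤ.*-zeroʳ (u ^ 3) ⟩
      + 0                         ∎)
      where
      isolate : ∀ r t → + 2 * t ≡ + 0 + r * + 0 + + 2 * t
      isolate = solve-∀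

  transform⇒scaling : ∀ {a b c d u r s t} → TransformsVia p (short a b) (short c d) u r s t →
                      u ^ 4 * c ≈ a × u ^ 6 * d ≈ b
  transform⇒scaling {a} {b} {c} {d} {u} {r} {s} {t} transform@(_ , _ , _ , e₄ , e₆) = u⁴c≈a , u⁶d≈b
    where
    shifts≈0 : r ≈ + 0 × s ≈ + 0 × t ≈ + 0
    shifts≈0 = transform⇒shifts≈0 {a} {b} {c} {d} {u} {r} {s} {t} transform

    r≈0 : r ≈ + 0
    r≈0 = proj₁ shifts≈0

    t≈0 : t ≈ + 0
    t≈0 = proj₂ (proj₂ shifts≈0)

    u⁴c≈a : u ^ 4 * c ≈ a
    u⁴c≈a = begin
      u ^ 4 * c
        ≈⟨ mod⇒≈ {u ^ 4 * c} {a - s * + 0 + + 2 * r * + 0 - (t + r * s) * + 0 + + 3 * r ^ 2 - + 2 * s * t} e₄ ⟩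
      a - s * + 0 + + 2 * r * + 0 - (t + r * s) * + 0 + + 3 * r ^ 2 - + 2 * s * t
        ≡⟨ isolate a r s t ⟩
      a + (r * (+ 3 * r) - t * (+ 2 * s))
        ≈⟨ +-cong (≈-refl {a}) (+-cong (*-zeroˡ-≈ r≈0) (-‿cong (*-zeroˡ-≈ t≈0))) ⟩
      a + + 0
        ≡⟨ ℤ.+-identityʳ a ⟩
      a ∎
      where
      isolate : ∀ a r s t →
        a - s * + 0 + + 2 * r * + 0 - (t + r * s) * + 0 + + 3 * (r * (r * + 1)) - + 2 * s * t
          ≡ a + (r * (+ 3 * r) - t * (+ 2 * s))
      isolate = solve-∀

    u⁶d≈b : u ^ 6 * d ≈ b
    u⁶d≈b = begin
      u ^ 6 * d
        ≈⟨ mod⇒≈ {u ^ 6 * d} {b + r * a + r ^ 2 * + 0 + r ^ 3 - t * + 0 - t ^ 2 - r * t * + 0} e₆ ⟩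
      b + r * a + r ^ 2 * + 0 + r ^ 3 - t * + 0 - t ^ 2 - r * t * + 0
        ≡⟨ isolate a b r t ⟩
      b + (r * (a + r * r) - t * t)
        ≈⟨ +-cong (≈-refl {b}) (+-cong (*-zeroˡ-≈ r≈0) (-‿cong (*-zeroˡ-≈ t≈0))) ⟩
      b + + 0
        ≡⟨ ℤ.+-identityʳ b ⟩
      b ∎
      where
      isolate : ∀ a b r t →
        b + r * a + r * (r * + 1) * + 0 + r * (r * (r * + 1)) - t * + 0 - t * (t * + 1) - r * t * + 0
          ≡ b + (r * (a + r * r) - t * t)
      isolate = solve-∀

  iso⇔scaling : ∀ {a b c d} → IsoOver p (short a b) (short c d) ⇔ ScalingIso a b c d
  iso⇔scaling {a} {b} {c} {d} = mk⇔ to from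
    where
    to : IsoOver p (short a b) (short c d) → ScalingIso a b c d
    to (u , r , s , t , u≢0 , transform) =
      u , (λ u≈0 → u≢0 (≈⇒mod u≈0)) , transform⇒scaling {a} {b} {c} {d} {u} {r} {s} {t} transform

    from : ScalingIso a b c d → IsoOver p (short a b) (short c d)
    from (u , u≉0 , u⁴c≈a , u⁶d≈b) =
      u , + 0 , + 0 , + 0 , (λ u≡0 → u≉0 (mod⇒≈ u≡0)) ,
      ≈⇒mod (≈-reflexive (ℤ.*-zeroʳ u)) ,
      ≈⇒mod (≈-reflexive (ℤ.*-zeroʳ (u ^ 2))) ,
      ≈⇒mod (≈-reflexive (ℤ.*-zeroʳ (u ^ 3))) ,
      ≈⇒mod (≈-trans u⁴c≈a (≈-reflexive (pad₄ a))) ,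
      ≈⇒mod (≈-trans u⁶d≈b (≈-reflexive (pad₆ a b)))
      where
      pad₄ : ∀ a → a ≡ a - + 0 * + 0 + + 2 * + 0 * + 0 - (+ 0 + + 0 * + 0) * + 0 + + 3 * (+ 0) ^ 2 - + 2 * + 0 * + 0
      pad₄ = solve-∀
      pad₆ : ∀ a b → b ≡ b + + 0 * a + (+ 0) ^ 2 * + 0 + (+ 0) ^ 3 - + 0 * + 0 - (+ 0) ^ 2 - + 0 * + 0 * + 0
      pad₆ = solve-∀

  FourthSixthPowers : ℤ → ℤ → Set
  FourthSixthPowers α β = ∃[ w ] (w ^ 4 ≈ α × w ^ 6 ≈ β)

  scaling⇔powers : ∀ {a b c d a⁻¹ b⁻¹} → a * a⁻¹ ≈ + 1 → b * b⁻¹ ≈ + 1 → ¬ c * a⁻¹ ≈ + 0 →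
                   ScalingIso a b c d ⇔ FourthSixthPowers (c * a⁻¹) (d * b⁻¹)
  scaling⇔powers {a} {b} {c} {d} {a⁻¹} {b⁻¹} aa⁻¹≈1 bb⁻¹≈1 ca⁻¹≉0 = mk⇔ to from
    where
    powers⇔ : ∀ {u w} → u * w ≈ + 1 →
              (u ^ 4 * c ≈ a ⇔ w ^ 4 ≈ c * a⁻¹) × (u ^ 6 * d ≈ b ⇔ w ^ 6 ≈ d * b⁻¹)
    powers⇔ {u} {w} uw≈1 =
      x*c≈a⇔x⁻¹≈c*a⁻¹ {u ^ 4} {w ^ 4} {a} {a⁻¹} {c} (^-inverse {u} {w} 4 uw≈1) aa⁻¹≈1 ,
      x*c≈a⇔x⁻¹≈c*a⁻¹ {u ^ 6} {w ^ 6} {b} {b⁻¹} {d} (^-inverse {u} {w} 6 uw≈1) bb⁻¹≈1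

    to : ScalingIso a b c d → FourthSixthPowers (c * a⁻¹) (d * b⁻¹)
    to (u , u≉0 , u⁴c≈a , u⁶d≈b) =
      let u⁻¹ , uu⁻¹≈1 = inverse u≉0
          fourth , sixth = powers⇔ {u} {u⁻¹} uu⁻¹≈1
      in u⁻¹ , Equivalence.to fourth u⁴c≈a , Equivalence.to sixth u⁶d≈b

    from : FourthSixthPowers (c * a⁻¹) (d * b⁻¹) → ScalingIso a b c d
    from (w , w⁴≈ca⁻¹ , w⁶≈db⁻¹) =
      let w⁻¹ , ww⁻¹≈1 = inverse w≉0
          fourth , sixth = powers⇔ {w⁻¹} {w} (≈-trans (≈-reflexive (ℤ.*-comm w⁻¹ w)) ww⁻¹≈1)
      in w⁻¹ , x*y≈1⇒y≉0 {w} ww⁻¹≈1 , Equivalence.from fourth w⁴≈ca⁻¹ , Equivalence.from sixth w⁶≈db⁻¹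
      where
      w≉0 : ¬ w ≈ + 0
      w≉0 w≈0 = ca⁻¹≉0 (≈-trans (≈-sym w⁴≈ca⁻¹) (^-cong {w} {+ 0} 4 w≈0))

  powers⇒cube≈square : ∀ {α β} → FourthSixthPowers α β → α ^ 3 ≈ β ^ 2
  powers⇒cube≈square {α} {β} (w , w⁴≈α , w⁶≈β) = begin
    α ^ 3          ≈⟨ ^-cong {w ^ 4} {α} 3 w⁴≈α ⟨
    (w ^ 4) ^ 3    ≡⟨ trans (ℤ.^-*-assoc w 4 3) (sym (ℤ.^-*-assoc w 6 2)) ⟩
    (w ^ 6) ^ 2    ≈⟨ ^-cong {w ^ 6} {β} 2 w⁶≈β ⟩
    β ^ 2          ∎

  powers⇔fourth-power : ∀ {α β} → ∃[ i ] i * i ≈ - + 1 →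
    FourthSixthPowers α β ⇔ (BiquadraticResidue p α × α ^ 3 ≈ β ^ 2)
  powers⇔fourth-power {α} {β} (i , i²≈-1) = mk⇔ to from
    where
    to : FourthSixthPowers α β → BiquadraticResidue p α × α ^ 3 ≈ β ^ 2
    to powers@(w , w⁴≈α , _) = (w , ≈⇒mod w⁴≈α) , powers⇒cube≈square powers

    from : BiquadraticResidue p α × α ^ 3 ≈ β ^ 2 → FourthSixthPowers α β
    from ((x , x⁴≡α) , α³≈β²) =
      [ (λ x⁶≈β → x , x⁴≈α , x⁶≈β) , (λ x⁶≈-β → i * x , ix⁴≈α , ix⁶≈β x⁶≈-β) ]′
        (x*x≈y*y⇒x≈±y {x ^ 6} {β} x⁶x⁶≈ββ)
      where
      x⁴≈α : x ^ 4 ≈ α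
      x⁴≈α = mod⇒≈ x⁴≡α

      x⁶x⁶≈ββ : x ^ 6 * x ^ 6 ≈ β * β
      x⁶x⁶≈ββ = begin
        x ^ 6 * x ^ 6   ≡⟨ solve 1 (λ x → x :^ 6 :* x :^ 6 := (x :^ 4) :^ 3) refl x ⟩
        (x ^ 4) ^ 3     ≈⟨ ^-cong {x ^ 4} {α} 3 x⁴≈α ⟩
        α ^ 3           ≈⟨ α³≈β² ⟩
        β ^ 2           ≡⟨ cong (β *_) (ℤ.*-identityʳ β) ⟩
        β * β           ∎

      ix⁴≈α : (i * x) ^ 4 ≈ α
      ix⁴≈α = begin
        (i * x) ^ 4           ≡⟨ solve 2 (λ i x → (i :* x) :^ 4 := (i :* i) :^ 2 :* x :^ 4) refl i x ⟩
        (i * i) ^ 2 * x ^ 4   ≈⟨ *-cong (^-cong {i * i} { - + 1} 2 i²≈-1) x⁴≈α ⟩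
        (- + 1) ^ 2 * α       ≡⟨ ℤ.*-identityˡ α ⟩
        α                     ∎

      ix⁶≈β : x ^ 6 ≈ - β → (i * x) ^ 6 ≈ β
      ix⁶≈β x⁶≈-β = begin
        (i * x) ^ 6           ≡⟨ solve 2 (λ i x → (i :* x) :^ 6 := (i :* i) :^ 3 :* x :^ 6) refl i x ⟩
        (i * i) ^ 3 * x ^ 6   ≈⟨ *-cong (^-cong {i * i} { - + 1} 3 i²≈-1) x⁶≈-β ⟩
        (- + 1) ^ 3 * - β     ≡⟨ solve 1 (λ β → (:- con (+ 1)) :^ 3 :* (:- β) := β) refl β ⟩
        β                     ∎

  powers⇔squares : ∀ {α β} → ¬ α ≈ + 0 →
    FourthSixthPowers α β ⇔ (QuadraticResidue p α × QuadraticResidue p β × α ^ 3 ≈ β ^ 2)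
  powers⇔squares {α} {β} α≉0 = mk⇔ to from
    where
    to : FourthSixthPowers α β → QuadraticResidue p α × QuadraticResidue p β × α ^ 3 ≈ β ^ 2
    to powers@(w , w⁴≈α , w⁶≈β) =
      (w ^ 2 , ≈⇒mod (≈-trans (≈-reflexive (solve 1 (λ w → (w :^ 2) :^ 2 := w :^ 4) refl w)) w⁴≈α)) ,
      (w ^ 3 , ≈⇒mod (≈-trans (≈-reflexive (solve 1 (λ w → (w :^ 3) :^ 2 := w :^ 6) refl w)) w⁶≈β)) ,
      powers⇒cube≈square powers

    from : QuadraticResidue p α × QuadraticResidue p β × α ^ 3 ≈ β ^ 2 → FourthSixthPowers α β
    from ((y , y²≡α) , (z , z²≡β) , α³≈β²) = z * y⁻¹ , w⁴≈α , w⁶≈β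
      where
      y²≈α : y ^ 2 ≈ α
      y²≈α = mod⇒≈ y²≡α

      z²≈β : z ^ 2 ≈ β
      z²≈β = mod⇒≈ z²≡β

      y≉0 : ¬ y ≈ + 0
      y≉0 y≈0 = α≉0 (≈-trans (≈-sym y²≈α) (^-cong {y} {+ 0} 2 y≈0))

      y⁻¹ : ℤ
      y⁻¹ = proj₁ (inverse y≉0)

      yy⁻¹≈1 : y * y⁻¹ ≈ + 1
      yy⁻¹≈1 = proj₂ (inverse y≉0)

      z⁴≈y⁶ : (z ^ 2) ^ 2 ≈ (y ^ 2) ^ 3
      z⁴≈y⁶ = begin
        (z ^ 2) ^ 2   ≈⟨ ^-cong {z ^ 2} {β} 2 z²≈β ⟩
        β ^ 2         ≈⟨ α³≈β² ⟨
        α ^ 3         ≈⟨ ^-cong {y ^ 2} {α} 3 y²≈α ⟨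
        (y ^ 2) ^ 3   ∎

      w⁴≈α : (z * y⁻¹) ^ 4 ≈ α
      w⁴≈α = begin
        (z * y⁻¹) ^ 4
          ≡⟨ solve 2 (λ z y⁻¹ → (z :* y⁻¹) :^ 4 := (z :^ 2) :^ 2 :* y⁻¹ :^ 4) refl z y⁻¹ ⟩
        (z ^ 2) ^ 2 * y⁻¹ ^ 4
          ≈⟨ *-cong z⁴≈y⁶ (≈-refl {y⁻¹ ^ 4}) ⟩
        (y ^ 2) ^ 3 * y⁻¹ ^ 4
          ≡⟨ solve 2 (λ y y⁻¹ → (y :^ 2) :^ 3 :* y⁻¹ :^ 4 := (y :* y⁻¹) :^ 4 :* y :^ 2) refl y y⁻¹ ⟩
        (y * y⁻¹) ^ 4 * y ^ 2
          ≈⟨ *-cong (^-cong {y * y⁻¹} {+ 1} 4 yy⁻¹≈1) y²≈α ⟩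
        + 1 * α
          ≡⟨ ℤ.*-identityˡ α ⟩
        α ∎

      w⁶≈β : (z * y⁻¹) ^ 6 ≈ β
      w⁶≈β = begin
        (z * y⁻¹) ^ 6
          ≡⟨ solve 2 (λ z y⁻¹ → (z :* y⁻¹) :^ 6 := z :^ 2 :* (z :^ 2) :^ 2 :* y⁻¹ :^ 6) refl z y⁻¹ ⟩
        z ^ 2 * (z ^ 2) ^ 2 * y⁻¹ ^ 6
          ≈⟨ *-cong (*-cong z²≈β z⁴≈y⁶) (≈-refl {y⁻¹ ^ 6}) ⟩
        β * (y ^ 2) ^ 3 * y⁻¹ ^ 6
          ≡⟨ solve 3 (λ β y y⁻¹ → β :* (y :^ 2) :^ 3 :* y⁻¹ :^ 6 := β :* (y :* y⁻¹) :^ 6) refl β y y⁻¹ ⟩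
        β * (y * y⁻¹) ^ 6
          ≈⟨ *-cong (≈-refl {β}) (^-cong {y * y⁻¹} {+ 1} 6 yy⁻¹≈1) ⟩
        β * + 1
          ≡⟨ ℤ.*-identityʳ β ⟩
        β ∎

  cube≈square⇔expanded : ∀ {c d a⁻¹ b⁻¹} →
    (c * a⁻¹) ^ 3 ≈ (d * b⁻¹) ^ 2 ⇔ (c ^ 3 * a⁻¹ ^ 3 ≡ d ^ 2 * b⁻¹ ^ 2 [mod p ])
  cube≈square⇔expanded {c} {d} {a⁻¹} {b⁻¹} = mk⇔
    (λ α³≈β² → ≈⇒mod (≈-trans (≈-reflexive (sym cube)) (≈-trans α³≈β² (≈-reflexive square))))
    (λ α³≡β² → ≈-trans (≈-reflexive cube) (≈-trans (mod⇒≈ α³≡β²) (≈-reflexive (sym square))))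
    where
    cube : (c * a⁻¹) ^ 3 ≡ c ^ 3 * a⁻¹ ^ 3
    cube = solve 2 (λ c a⁻¹ → (c :* a⁻¹) :^ 3 := c :^ 3 :* a⁻¹ :^ 3) refl c a⁻¹
    square : (d * b⁻¹) ^ 2 ≡ d ^ 2 * b⁻¹ ^ 2
    square = solve 2 (λ d b⁻¹ → (d :* b⁻¹) :^ 2 := d :^ 2 :* b⁻¹ :^ 2) refl d b⁻¹

lemma10 : (p : ℕ) → Prime p → 3 < p →
    (a b c d a⁻¹ b⁻¹ : ℤ) →
    ¬ ((+ p) ∣ (a * b * c * d)) →
    a * a⁻¹ ≡ + 1 [mod p ] → b * b⁻¹ ≡ + 1 [mod p ] →
    (p % 4 ≡ 1 →
      IsoOver p (short a b) (short c d) ⇔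
        (BiquadraticResidue p (c * a⁻¹) ×
         (c ^ 3 * a⁻¹ ^ 3 ≡ d ^ 2 * b⁻¹ ^ 2 [mod p ])))
    ×
    (p % 4 ≡ 3 →
      IsoOver p (short a b) (short c d) ⇔
        (QuadraticResidue p (c * a⁻¹) × QuadraticResidue p (d * b⁻¹) ×
         (c ^ 3 * a⁻¹ ^ 3 ≡ d ^ 2 * b⁻¹ ^ 2 [mod p ])))
lemma10 p p-prime 3<p a b c d a⁻¹ b⁻¹ p∤abcd aa⁻¹≡1 bb⁻¹≡1 =
  (λ p%4≡1 → (⇔-id _ ×-⇔ cube⇔) ⇔-∘ (powers⇔fourth-power {α} {β} (√-1 p%4≡1) ⇔-∘ iso⇔powers)) ,
  (λ _ → (⇔-id _ ×-⇔ (⇔-id _ ×-⇔ cube⇔)) ⇔-∘ (powers⇔squares {α} {β} α≉0 ⇔-∘ iso⇔powers))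
  where
  open Congruence p
  open PrimeModulus p p-prime
  open ShortWeierstrass p p-prime 3<p

  α β : ℤ
  α = c * a⁻¹
  β = d * b⁻¹

  aa⁻¹≈1 : a * a⁻¹ ≈ + 1
  aa⁻¹≈1 = mod⇒≈ aa⁻¹≡1

  c≉0 : ¬ c ≈ + 0
  c≉0 c≈0 = p∤abcd (≈0⇒∣ (*-zeroˡ-≈ {a * b * c} {d} (*-zeroʳ-≈ {c} {a * b} c≈0)))

  α≉0 : ¬ α ≈ + 0
  α≉0 = x≉0∧y≉0⇒x*y≉0 {c} {a⁻¹} c≉0 (x*y≈1⇒y≉0 {a} aa⁻¹≈1)

  iso⇔powers : IsoOver p (short a b) (short c d) ⇔ FourthSixthPowers α β
  iso⇔powers = scaling⇔powers {a} {b} {c} {d} {a⁻¹} {b⁻¹} aa⁻¹≈1 (mod⇒≈ bb⁻¹≡1) α≉0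
           ⇔-∘ iso⇔scaling {a} {b} {c} {d}

  cube⇔ : α ^ 3 ≈ β ^ 2 ⇔ (c ^ 3 * a⁻¹ ^ 3 ≡ d ^ 2 * b⁻¹ ^ 2 [mod p ])
  cube⇔ = cube≈square⇔expanded {c} {d} {a⁻¹} {b⁻¹}
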